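{- For every monotone neighbourhood structure $\mathcal N$, every normal-form $\mathsf{GL_s}$ formula $\varphi$ and every normal-form $\mathsf{GL_s}$ game $\alpha$: $[\![\overline{\varphi}]\!]_{\mathcal N}=([\![\varphi]\!]_{\mathcal N})^\circ$ and $[\![\alpha^\partial]\!]_{\mathcal N}=([\![\alpha]\!]_{\mathcal N})^\circ$, where $\overline{\varphi}$ is the syntactic complement and $\alpha^\partial$ the syntactic dual.
   Context: Fix countably infinite sets $\mathbb A$ of propositional constants and $\mathbb G$ of atomic games. A monotone neighbourhood structure is $\mathcal N=(W,V,E)$ with $W$ a set, $V:\mathbb A\to\mathcal P(W)$ and $E$ assigning to each $a\in\mathbb G$ a monotone map $E(a):\mathcal P(W)\to\mathcal P(W)$; the dual of a monotone $w$ is $w^d(A)=W\setminus w(W\setminus A)$. Sabotage game logic $\mathsf{GL_s}$: formulas $\varphi::=P\mid\neg\varphi\mid\varphi\lor\varphi\mid\langle\alpha\rangle\varphi$ ($P\in\mathbb A$); games $\alpha::=a\mid\mathsf{trap}(a)\mid ?\varphi\mid\alpha\cup\alpha\mid\alpha;\alpha\mid\alpha^*\mid\alpha^d$ ($a\in\mathbb G$). Abbreviations: $\land,\top,\bot$ as usual, $\alpha\cap\beta:=(\alpha^d\cup\beta^d)^d$, $?^d\varphi:=(?\varphi)^d$, $\alpha^\times:=((\alpha^d)^*)^d$. A context is a map $c:\mathbb G\to\{\mathsf 0,\mathsf A,\mathsf D\}$ with $c(a)=\mathsf 0$ for all but finitely many $a$; $\mathcal C$ is the set of contexts; $c[a\mapsto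 v]$ is $c$ modified at $a$; $\bar c$ swaps the values $\mathsf A$ and $\mathsf D$. For $U\subseteq W\times\mathcal C$: $U|_c=\{\omega:(\omega,c)\in U\}$ and $U^\circ=\{(\omega,c):(\omega,\bar c)\notin U\}$; for monotone $w:\mathcal P(W\times\mathcal C)\to\mathcal P(W\times\mathcal C)$, the sabotage dual is $w^\circ(U)=(w(U^\circ))^\circ$. Semantics $[\![\varphi]\!]\subseteq W\times\mathcal C$, $[\![\alpha]\!]$ monotone on $\mathcal P(W\times\mathcal C)$: $[\![P]\!]=V(P)\times\mathcal C$; $[\![\neg\varphi]\!]=[\![\varphi]\!]^\circ$; $[\![\varphi\lor\psi]\!]=[\![\varphi]\!]\cup[\![\psi]\!]$; $[\![\langle\alpha\rangle\varphi]\!]=[\![\alpha]\!]([\![\varphi]\!])$; $(\omega,c)\in[\![a]\!](U)$ iff ($c(a)=\mathsf 0$ and $\omega\in E(a)(U|_c)$) or ($c(a)=\mathsf A$ and $(\omega,c)\in U$); $[\![\mathsf{trap}(a)]\!](U)=\{(\omega,c):(\omega,c[a\mapsto\mathsf A])\in U\}$; $[\![?\varphi]\!](U)=[\![\varphi]\!]\cap U$; $[\![\alpha\cup\beta]\!](U)=[\![\alpha]\!](U)\cup[\![\beta]\!](U)$; $[\![\alpha;\beta]\!]=[\![\alpha]\!]\circ[\![\beta]\!]$; $[\![\alpha^*]\!](U)$ is the least fixpoint of $B\mapsto U\cup[\![\alpha]\!](B)$; $[\![\alpha^d]\!]=[\![\alpha]\!]^\circ$. Normal form: formulas built from $P,\neg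 P,\lor,\land,\langle\alpha\rangle\varphi$ and games from $a,a^d,\mathsf{trap}(a),\mathsf{trap}(a)^d,?\varphi,?^d\varphi,\cup,\cap,;,{}^*,{}^\times$. Syntactic complement $\overline{\cdot}$ and dual $\cdot^\partial$ (mutually recursive): $\overline P=\neg P$, $\overline{\neg P}=P$, $\overline{\varphi\land\psi}=\overline\varphi\lor\overline\psi$, $\overline{\varphi\lor\psi}=\overline\varphi\land\overline\psi$, $\overline{\langle\alpha\rangle\varphi}=\langle\alpha^\partial\rangle\overline\varphi$; $a^\partial=a^d$, $(a^d)^\partial=a$, $\mathsf{trap}(a)^\partial=\mathsf{trap}(a)^d$, $(\mathsf{trap}(a)^d)^\partial=\mathsf{trap}(a)$, $(?\varphi)^\partial=?^d\varphi$, $(?^d\varphi)^\partial=?\varphi$, $(\alpha\cup\beta)^\partial=\alpha^\partial\cap\beta^\partial$, $(\alpha\cap\beta)^\partial=\alpha^\partial\cup\beta^\partial$, $(\alpha;\beta)^\partial=\alpha^\partial;\beta^\partial$, $(\alpha^*)^\partial=(\alpha^\partial)^\times$, $(\alpha^\times)^\partial=(\alpha^\partial)^*$. -}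

module Defs where

open import Data.Nat using (ℕ; zero; suc)
open import Data.Bool using (Bool; true; false; not; _∨_; _∧_)
open import Data.Product using (_×_; _,_)
open import Relation.Nullary using (Dec; does)
open import Relation.Binary.PropositionalEquality using (_≡_)

-- Subsets are Bool-valued predicates (classical powerset; the least
-- fixpoint below is decided by an excluded-middle oracle).

Pow : Set → Set
Pow X = X → Bool

_⊆_ : {X : Set} → Pow X → Pow X → Set
A ⊆ B = ∀ x → A x ≡ true → B x ≡ true

_∪_ : {X : Set} → Pow X → Pow X → Pow X
(A ∪ B) x = A x ∨ B x

_∩_ : {X : Set} → Pow X → Pow X → Pow X
(A ∩ B) x = A x ∧ B x

LEM : Set₁
LEM = (P : Set) → Dec P

-- Least fixpoint of F (Knaster–Tarski): intersection of all prefixed points.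
lfp : LEM → {X : Set} → (Pow X → Pow X) → Pow X
lfp lem {X} F x = does (lem ((B : Pow X) → F B ⊆ B → B x ≡ true))

Atom : Set
Atom = ℕ

AGame : Set
AGame = ℕ

record MNS : Set₁ where
  field
    W      : Set
    V      : Atom → Pow W
    E      : AGame → Pow W → Pow W
    E-mono : ∀ a {U U′ : Pow W} → U ⊆ U′ → E a U ⊆ E a U′

-- Contexts: maps 𝔾 → {0, A, D} with finite support.  Represented
-- canonically (bijectively) as either the everywhere-0 context or a
-- finite nonempty list whose last entry is nonzero (value 0 beyond it).

data Val : Set where
  V0 VA VD : Val

data NZ : Set where
  nA nD : NZ

toVal : NZ → Val
toVal nA = VA
toVal nD = VD

data Tail : Set where
  last : NZ → Tail
  _∷_  : Val → Tail → Tail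

data Ctx : Set where
  ∅  : Ctx
  ne : Tail → Ctx

lookupT : Tail → AGame → Val
lookupT (last v) zero    = toVal v
lookupT (last v) (suc n) = V0
lookupT (v ∷ t)  zero    = v
lookupT (v ∷ t)  (suc n) = lookupT t n

_at_ : Ctx → AGame → Val
∅    at a = V0
ne t at a = lookupT t a

single : AGame → NZ → Tail
single zero    w = last w
single (suc n) w = V0 ∷ single n w

setT : Tail → AGame → NZ → Tail
setT (last v) zero    w = last w
setT (last v) (suc n) w = toVal v ∷ single n w
setT (v ∷ t)  zero    w = toVal w ∷ t
setT (v ∷ t)  (suc n) w = v ∷ setT t n w

_[_↦A] : Ctx → AGame → Ctx
∅    [ a ↦A] = ne (single a nA)
ne t [ a ↦A] = ne (setT t a nA)

barV : Val → Val
barV V0 = V0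
barV VA = VD
barV VD = VA

barNZ : NZ → NZ
barNZ nA = nD
barNZ nD = nA

barT : Tail → Tail
barT (last v) = last (barNZ v)
barT (v ∷ t)  = barV v ∷ barT t

bar : Ctx → Ctx
bar ∅      = ∅
bar (ne t) = ne (barT t)

module _ {W : Set} where
  _° : Pow (W × Ctx) → Pow (W × Ctx)
  (U °) (ω , c) = not (U (ω , bar c))

  _°ᵍ : (Pow (W × Ctx) → Pow (W × Ctx)) → (Pow (W × Ctx) → Pow (W × Ctx))
  (w °ᵍ) U = (w (U °)) °

  _∣_ : Pow (W × Ctx) → Ctx → Pow W
  (U ∣ c) ω = U (ω , c)

mutual
  data Fm : Set where
    atom : Atom → Fm
    ¬′_  : Fm → Fm
    _∨′_ : Fm → Fm → Fm
    ⟨_⟩_ : Gm → Fm → Fm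

  data Gm : Set where
    g     : AGame → Gm
    trap  : AGame → Gm
    ¿_    : Fm → Gm
    _∪′_  : Gm → Gm → Gm
    _⨟_   : Gm → Gm → Gm
    _*    : Gm → Gm
    _ᵈ    : Gm → Gm

_∧′_ : Fm → Fm → Fm
φ ∧′ ψ = ¬′ ((¬′ φ) ∨′ (¬′ ψ))

_∩′_ : Gm → Gm → Gm
α ∩′ β = ((α ᵈ) ∪′ (β ᵈ)) ᵈ

¿ᵈ_ : Fm → Gm
¿ᵈ φ = (¿ φ) ᵈ

_× : Gm → Gm
α × = ((α ᵈ) *) ᵈ

module Sem (lem : LEM) (N : MNS) where
  open MNS N

  S : Set
  S = W × Ctx

  atomic : AGame → Pow S → Pow S
  atomic a U (ω , c) with c at a
  ... | V0 = E a (U ∣ c) ω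
  ... | VA = U (ω , c)
  ... | VD = false

  mutual
    ⟦_⟧f : Fm → Pow S
    ⟦ atom P ⟧f (ω , c) = V P ω
    ⟦ ¬′ φ ⟧f = ⟦ φ ⟧f °
    ⟦ φ ∨′ ψ ⟧f = ⟦ φ ⟧f ∪ ⟦ ψ ⟧f
    ⟦ ⟨ α ⟩ φ ⟧f = ⟦ α ⟧g ⟦ φ ⟧f

    ⟦_⟧g : Gm → Pow S → Pow S
    ⟦ g a ⟧g U = atomic a U
    ⟦ trap a ⟧g U (ω , c) = U (ω , c [ a ↦A])
    ⟦ ¿ φ ⟧g U = ⟦ φ ⟧f ∩ U
    ⟦ α ∪′ β ⟧g U = ⟦ α ⟧g U ∪ ⟦ β ⟧g U
    ⟦ α ⨟ β ⟧g U = ⟦ α ⟧g (⟦ β ⟧g U)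
    ⟦ α * ⟧g U = lfp lem (λ B → U ∪ ⟦ α ⟧g B)
    ⟦ α ᵈ ⟧g U = (⟦ α ⟧g °ᵍ) U

mutual
  data NFm : Set where
    pos  : Atom → NFm
    neg  : Atom → NFm
    _or_  : NFm → NFm → NFm
    _and_ : NFm → NFm → NFm
    ⟪_⟫_ : NGm → NFm → NFm

  data NGm : Set where
    ga     : AGame → NGm
    gaᵈ    : AGame → NGm
    tr     : AGame → NGm
    trᵈ    : AGame → NGm
    test   : NFm → NGm
    testᵈ  : NFm → NGm
    _cup_  : NGm → NGm → NGm
    _cap_  : NGm → NGm → NGm
    _seq_  : NGm → NGm → NGm
    _star  : NGm → NGm
    _cross : NGm → NGm

mutual
  embF : NFm → Fm
  embF (pos P)     = atom P
  embF (neg P)     = ¬′ atom P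
  embF (φ or ψ)    = embF φ ∨′ embF ψ
  embF (φ and ψ)   = embF φ ∧′ embF ψ
  embF (⟪ α ⟫ φ)   = ⟨ embG α ⟩ embF φ

  embG : NGm → Gm
  embG (ga a)      = g a
  embG (gaᵈ a)     = g a ᵈ
  embG (tr a)      = trap a
  embG (trᵈ a)     = trap a ᵈ
  embG (test φ)    = ¿ embF φ
  embG (testᵈ φ)   = ¿ᵈ embF φ
  embG (α cup β)   = embG α ∪′ embG β
  embG (α cap β)   = embG α ∩′ embG β
  embG (α seq β)   = embG α ⨟ embG β
  embG (α star)    = embG α *
  embG (α cross)   = embG α ×

mutual
  compl : NFm → NFm
  compl (pos P)   = neg P
  compl (neg P)   = pos P
  compl (φ and ψ) = compl φ or compl ψ
  compl (φ or ψ)  = compl φ and compl ψ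
  compl (⟪ α ⟫ φ) = ⟪ dual α ⟫ compl φ

  dual : NGm → NGm
  dual (ga a)    = gaᵈ a
  dual (gaᵈ a)   = ga a
  dual (tr a)    = trᵈ a
  dual (trᵈ a)   = tr a
  dual (test φ)  = testᵈ φ
  dual (testᵈ φ) = test φ
  dual (α cup β) = dual α cap dual β
  dual (α cap β) = dual α cup dual β
  dual (α seq β) = dual α seq dual β
  dual (α star)  = dual α cross
  dual (α cross) = dual α star

{-# OPTIONS --safe #-}
module Submission where

-- Sabotage complementation U ↦ U° and its lift w ↦ w° to game maps are
-- involutions, because bar is.  Every game denotes a map respecting
-- pointwise equality, so by simultaneous induction on normal forms each
-- clause of compl and dual is a de Morgan law for °: double complementation
-- for negated atoms and dualised games, and for ∪, ; and * the fact that °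
-- can be pushed through the operation (through lfp because lfp only depends
-- on its operator up to pointwise equality).

open import Defs
open import Data.Bool using (Bool; not; _∨_; _∧_)
open import Data.Bool.Properties using (not-involutive; ⇔→≡)
open import Data.Product using (_×_; _,_)
open import Function using (_∘_)
open import Function.Bundles using (mk⇔)
open import Relation.Binary.Bundles using (Setoid)
open import Relation.Binary.Core using (_Preserves_⟶_)
open import Relation.Binary.PropositionalEquality
  using (_≡_; refl; sym; trans; cong; cong₂; _≗_; _→-setoid_)
open import Relation.Nullary.Decidable using (does-⇔)

barNZ-involutive : ∀ v → barNZ (barNZ v) ≡ v
barNZ-involutive nA = refl
barNZ-involutive nD = refl

barV-involutive : ∀ v → barV (barV v) ≡ v
barV-involutive V0 = refl
barV-involutive VA = refl
barV-involutive VD = refl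

barT-involutive : ∀ t → barT (barT t) ≡ t
barT-involutive (last v) = cong last (barNZ-involutive v)
barT-involutive (v ∷ t)  = cong₂ _∷_ (barV-involutive v) (barT-involutive t)

bar-involutive : ∀ c → bar (bar c) ≡ c
bar-involutive ∅      = refl
bar-involutive (ne t) = cong ne (barT-involutive t)

module _ {X : Set} where
  open Setoid (X →-setoid Bool) using () renaming (sym to ≗-sym)

  ≗⇒⊆ : {A B : Pow X} → A ≗ B → A ⊆ B
  ≗⇒⊆ A≗B x = trans (sym (A≗B x))

  ⊆-antisym : {A B : Pow X} → A ⊆ B → B ⊆ A → A ≗ B
  ⊆-antisym A⊆B B⊆A x = ⇔→≡ (mk⇔ (A⊆B x) (B⊆A x))

  ∪-cong : {A A′ B B′ : Pow X} → A ≗ A′ → B ≗ B′ → A ∪ B ≗ A′ ∪ B′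
  ∪-cong A≗A′ B≗B′ x = cong₂ _∨_ (A≗A′ x) (B≗B′ x)

  lfp-cong : (lem : LEM) {F G : Pow X → Pow X} →
             (∀ B → F B ≗ G B) → lfp lem F ≗ lfp lem G
  lfp-cong lem F≗G x = does-⇔
    (mk⇔ (λ h B GB⊆B → h B (λ y → GB⊆B y ∘ ≗⇒⊆ (F≗G B) y))
         (λ h B FB⊆B → h B (λ y → FB⊆B y ∘ ≗⇒⊆ (≗-sym (F≗G B)) y)))
    (lem _) (lem _)

module _ {W : Set} where
  open Setoid ((W × Ctx) →-setoid Bool) using ()
    renaming (sym to ≗-sym; trans to ≗-trans)

  Congruent : (Pow (W × Ctx) → Pow (W × Ctx)) → Set
  Congruent w = w Preserves _≗_ ⟶ _≗_

  °-cong : {U U′ : Pow (W × Ctx)} → U ≗ U′ → U ° ≗ U′ °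
  °-cong U≗U′ (ω , c) = cong not (U≗U′ (ω , bar c))

  °-involutive : (U : Pow (W × Ctx)) → (U °) ° ≗ U
  °-involutive U (ω , c) rewrite bar-involutive c = not-involutive (U (ω , c))

  °-transpose : {U V : Pow (W × Ctx)} → U ≗ V ° → U ° ≗ V
  °-transpose {V = V} U≗V° = ≗-trans (°-cong U≗V°) (°-involutive V)

  °ᵍ-cong : {w : Pow (W × Ctx) → Pow (W × Ctx)} → Congruent w → Congruent (w °ᵍ)
  °ᵍ-cong w-cong = °-cong ∘ w-cong ∘ °-cong

  °ᵍ-involutive : {w : Pow (W × Ctx) → Pow (W × Ctx)} → Congruent w →
                  ∀ U → ((w °ᵍ) °ᵍ) U ≗ w U
  °ᵍ-involutive w-cong U = ≗-trans (°-involutive _) (w-cong (°-involutive U))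

  °ᵍ-transpose : {v w : Pow (W × Ctx) → Pow (W × Ctx)} → Congruent w →
                 (∀ U → v U ≗ (w °ᵍ) U) → ∀ U → (v °ᵍ) U ≗ w U
  °ᵍ-transpose w-cong v≗w° U = ≗-trans (°-cong (v≗w° (U °))) (°ᵍ-involutive w-cong U)

  °ᵍ-distrib-∘ : {v w : Pow (W × Ctx) → Pow (W × Ctx)} → Congruent v →
                 ∀ U → (v °ᵍ) ((w °ᵍ) U) ≗ ((v ∘ w) °ᵍ) U
  °ᵍ-distrib-∘ v-cong U = °-cong (v-cong (°-involutive _))

module Correctness (lem : LEM) (N : MNS) where
  open MNS N
  open Sem lem N
  open Setoid (S →-setoid Bool) using ()
    renaming (refl to ≗-refl; sym to ≗-sym; trans to ≗-trans)
  open import Relation.Binary.Reasoning.Setoid (S →-setoid Bool)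

  E-cong : ∀ a → E a Preserves _≗_ ⟶ _≗_
  E-cong a U≗U′ = ⊆-antisym (E-mono a (≗⇒⊆ U≗U′)) (E-mono a (≗⇒⊆ (sym ∘ U≗U′)))

  atomic-cong : ∀ a → Congruent (atomic a)
  atomic-cong a U≗U′ (ω , c) with c at a
  ... | V0 = E-cong a (λ ω′ → U≗U′ (ω′ , c)) ω
  ... | VA = U≗U′ (ω , c)
  ... | VD = refl

  ⟦_⟧g-cong : (α : Gm) → Congruent ⟦ α ⟧g
  ⟦ g a ⟧g-cong                 = atomic-cong a
  ⟦ trap a ⟧g-cong U≗U′ (ω , c) = U≗U′ (ω , c [ a ↦A])
  ⟦ ¿ φ ⟧g-cong U≗U′ x          = cong (⟦ φ ⟧f x ∧_) (U≗U′ x)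
  ⟦ α ∪′ β ⟧g-cong U≗U′         = ∪-cong (⟦ α ⟧g-cong U≗U′) (⟦ β ⟧g-cong U≗U′)
  ⟦ α ⨟ β ⟧g-cong               = ⟦ α ⟧g-cong ∘ ⟦ β ⟧g-cong
  ⟦ α * ⟧g-cong U≗U′            = lfp-cong lem (λ B → ∪-cong U≗U′ ≗-refl)
  ⟦ α ᵈ ⟧g-cong                 = °ᵍ-cong ⟦ α ⟧g-cong

  doubly-dualised : (γ : Gm) → ∀ U → ⟦ γ ⟧g U ≗ ((⟦ γ ⟧g °ᵍ) °ᵍ) U
  doubly-dualised γ U = ≗-sym (°ᵍ-involutive ⟦ γ ⟧g-cong U)

  mutual
    compl-correct : (φ : NFm) → ⟦ embF (compl φ) ⟧f ≗ ⟦ embF φ ⟧f °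
    compl-correct (pos P)   = ≗-refl
    compl-correct (neg P)   = ≗-sym (°-involutive ⟦ atom P ⟧f)
    compl-correct (φ or ψ)  =
      °-cong (∪-cong (complemented-compl-correct φ) (complemented-compl-correct ψ))
    compl-correct (φ and ψ) =
      ≗-trans (∪-cong (compl-correct φ) (compl-correct ψ)) (≗-sym (°-involutive _))
    compl-correct (⟪ α ⟫ φ) =
      ≗-trans (dual-correct α _)
              (°-cong (⟦ embG α ⟧g-cong (complemented-compl-correct φ)))

    complemented-compl-correct : (φ : NFm) → ⟦ embF (compl φ) ⟧f ° ≗ ⟦ embF φ ⟧f
    complemented-compl-correct φ = °-transpose (compl-correct φ)

    dual-correct : (α : NGm) → ∀ U → ⟦ embG (dual α) ⟧g U ≗ (⟦ embG α ⟧g °ᵍ) U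
    dual-correct (ga a)    U = ≗-refl
    dual-correct (gaᵈ a)   U = doubly-dualised (g a) U
    dual-correct (tr a)    U = ≗-refl
    dual-correct (trᵈ a)   U = doubly-dualised (trap a) U
    dual-correct (test φ)  U = ≗-refl
    dual-correct (testᵈ φ) U = doubly-dualised (¿ embF φ) U
    dual-correct (α cup β) U =
      °-cong (∪-cong (dualised-dual-correct α (U °)) (dualised-dual-correct β (U °)))
    dual-correct (α cap β) U =
      ≗-trans (∪-cong (dual-correct α U) (dual-correct β U))
              (doubly-dualised ((embG α ᵈ) ∪′ (embG β ᵈ)) U)
    dual-correct (α seq β) U = begin
      ⟦ embG (dual α) ⟧g (⟦ embG (dual β) ⟧g U)  ≈⟨ dual-correct α _ ⟩
      (⟦ embG α ⟧g °ᵍ) (⟦ embG (dual β) ⟧g U)    ≈⟨ °ᵍ-cong ⟦ embG α ⟧g-cong (dual-correct β U) ⟩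
      (⟦ embG α ⟧g °ᵍ) ((⟦ embG β ⟧g °ᵍ) U)      ≈⟨ °ᵍ-distrib-∘ {w = ⟦ embG β ⟧g} ⟦ embG α ⟧g-cong U ⟩
      (⟦ embG (α seq β) ⟧g °ᵍ) U                 ∎
    dual-correct (α star)  U =
      °-cong (lfp-cong lem (λ B → ∪-cong ≗-refl (dualised-dual-correct α B)))
    dual-correct (α cross) U = begin
      lfp lem (λ B → U ∪ ⟦ embG (dual α) ⟧g B)  ≈⟨ lfp-cong lem (λ B → ∪-cong ≗-refl (dual-correct α B)) ⟩
      ⟦ (embG α ᵈ) * ⟧g U                       ≈⟨ doubly-dualised ((embG α ᵈ) *) U ⟩
      (⟦ embG (α cross) ⟧g °ᵍ) U                ∎

    dualised-dual-correct : (α : NGm) → ∀ U → (⟦ embG (dual α) ⟧g °ᵍ) U ≗ ⟦ embG α ⟧g U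
    dualised-dual-correct α = °ᵍ-transpose ⟦ embG α ⟧g-cong (dual-correct α)

lemma3p4 : (lem : LEM) (N : MNS) →
    let open Sem lem N in
    ((φ : NFm) → ∀ x → ⟦ embF (compl φ) ⟧f x ≡ (⟦ embF φ ⟧f °) x)
    × ((α : NGm) → ∀ U x → ⟦ embG (dual α) ⟧g U x ≡ (⟦ embG α ⟧g °ᵍ) U x)
lemma3p4 lem N = compl-correct , dual-correct
  where open Correctness lem N
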